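{- For any integers $n \geq 1$, $q \geq 2$ and any integer $v$ with $1 \leq v < q$ and $n + v - q \geq 1$, \[ f(n,q) \leq q - v + \mathsf{SAN}(n+v-q, n, v). \]
   Context: Let $\mathbb Z_q = \mathbb Z/q\mathbb Z$, and consider $\mathbb Z_q^n$ with the Hamming distance $d(x,y)$ = number of coordinates in which $x,y$ differ. Say $x$ skirts $y$ if $d(x,y) = n$. A set $S \subseteq \mathbb Z_q^n$ is a skirting set if every $y \in \mathbb Z_q^n$ is skirted by some $x \in S$; $f(n,q)$ is the minimum size of a skirting set in $\mathbb Z_q^n$. For an $n$-tuple $x$ and $T \subseteq \{1,\dots,n\}$, $x_T$ denotes the restriction of $x$ to the coordinates in $T$. An $N \times n$ array $M$ with entries from an alphabet of size $v$ is a skirting array of strength $t$, $\mathsf{SA}(N;t,n,v)$, if for every $t$-subset $T \subseteq \{1,\dots,n\}$ and every $t$-tuple $y$ over the alphabet there is a row $x$ of $M$ with $x_T$ differing from $y$ in all $t$ coordinates; $\mathsf{SAN}(t,n,v)$ is the minimum such $N$. (Here the $v$-letter alphabet is viewed as a subset of $\mathbb Z_q$.) -}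

module Defs where

open import Data.Nat using (ℕ; _≤_; _∸_; _+_)
open import Data.Fin using (Fin)
open import Data.Fin.Subset using (Subset; _∈_; ∣_∣)
open import Data.List using (List; length)
open import Data.List.Relation.Unary.Any using (Any)
open import Data.Product using (∃; _×_)
open import Relation.Binary.PropositionalEquality using (_≡_; _≢_)

Word : ℕ → ℕ → Set
Word n q = Fin n → Fin q

Skirts : ∀ {n q} → Word n q → Word n q → Set
Skirts {n} x y = (i : Fin n) → x i ≢ y i

IsSkirtingSet : (n q : ℕ) → List (Word n q) → Set
IsSkirtingSet n q S = (y : Word n q) → Any (λ x → Skirts x y) S

-- f(n,q) ≤ m  :⇔  there is a skirting set of size at most m.
fLe : ℕ → ℕ → ℕ → Set
fLe n q m = ∃ λ (S : List (Word n q)) → IsSkirtingSet n q S × length S ≤ m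

Array : ℕ → ℕ → ℕ → Set
Array N n v = Fin N → Fin n → Fin v

-- Skirting array SA(N; t, n, v): for every t-subset T of the columns and every
-- tuple y over the alphabet (indexed by the columns; only y_T matters) there is
-- a row x with x_T differing from y_T in all coordinates of T.
IsSkirtingArray : (N t n v : ℕ) → Array N n v → Set
IsSkirtingArray N t n v M =
  (T : Subset n) → ∣ T ∣ ≡ t → (y : Fin n → Fin v) →
  ∃ λ (r : Fin N) → (i : Fin n) → i ∈ T → M r i ≢ y i

HasSA : (N t n v : ℕ) → Set
HasSA N t n v = ∃ λ (M : Array N n v) → IsSkirtingArray N t n v M

-- The skirting set consists of the q − v constant words on the letters v, …, q − 1, together with
-- the rows of a skirting array over the letters 0, …, v − 1. A word y that misses one of the large
-- letters is skirted by the corresponding constant word. Otherwise y spends at least q − v of its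
-- coordinates on large letters, so at most n + v − q = t coordinates carry small letters; a t-set T
-- of columns containing them yields a row that avoids y on T, and off T the row (small) differs from
-- y (large) automatically.
module Submission where

open import Defs
open import Data.Nat using (ℕ; _≤_; _<_; _+_; _∸_; z≤n; s≤s)
open import Data.Nat.Properties
  using (≤-trans; ≤-reflexive; +-comm; >⇒≢; m≤n⇒m<n∨m≡n; m≤n+m; m≤o∸n⇒m+n≤o; +-cancelˡ-≤; +-cancelʳ-≡; +-assoc;
         m+[n∸m]≡n; m∸n+n≡m; m∸n≢0⇒n<m; <⇒≤)
open import Data.Fin using (Fin; zero; suc; _↑ˡ_; _↑ʳ_; splitAt; fromℕ<)
open import Data.Fin.Properties using (_≟_; any?; all?; ¬∀⟶∃¬; 0≢1+n; suc-injective; ↑ʳ-injective; splitAt-↑ˡ; splitAt-↑ʳ)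
open import Data.Fin.Subset using (Subset; Side; inside; outside; _∈_; _⊆_; _-_; ∁; ⊤; ∣_∣)
open import Data.Fin.Subset.Properties
  using (x∈p∧x≢y⇒x∈p-y; x∈p⇒∣p-x∣<∣p∣; s⊆s; ⊆⊤; ∣⊤∣≡n; ∣p∣≤n; x∉p⇒x∈∁p; ∣∁p∣≡n∸∣p∣)
open import Data.Vec using ([]; _∷_; tabulate)
open import Data.Vec.Properties using (lookup∘tabulate; lookup⇒[]=; []=⇒lookup)
open import Data.List using (List; length; _++_) renaming (tabulate to tabulateList)
open import Data.List.Properties using (length-++; length-tabulate)
open import Data.List.Relation.Unary.Any.Properties using (++⁺ˡ; ++⁺ʳ; tabulate⁺)
open import Data.Product using (∃; _×_; _,_; proj₁; proj₂; map)
open import Data.Sum using (inj₁; inj₂; [_,_]′)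
open import Relation.Nullary using (yes; no)
open import Function using (_∘_; id; const)
open import Function.Definitions using (Injective)
open import Relation.Binary.PropositionalEquality using (_≡_; _≢_; refl; sym; trans; cong; cong₂; module ≡-Reasoning)

injective⇒≤∣p∣ : ∀ {k n} (p : Subset n) (f : Fin k → Fin n) →
                 Injective _≡_ _≡_ f → (∀ c → f c ∈ p) → k ≤ ∣ p ∣
injective⇒≤∣p∣ {ℕ.zero} p f f-inj f∈p = z≤n
injective⇒≤∣p∣ {ℕ.suc k} p f f-inj f∈p =
  ≤-trans (s≤s (injective⇒≤∣p∣ (p - f zero) (f ∘ suc) (suc-injective ∘ f-inj) tail∈))
          (x∈p⇒∣p-x∣<∣p∣ (f∈p zero))
  where
  tail∈ : ∀ c → f (suc c) ∈ p - f zero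
  tail∈ c = x∈p∧x≢y⇒x∈p-y (f∈p (suc c)) (λ e → 0≢1+n (sym (f-inj e)))

⊆-extend : ∀ {n m} (p : Subset n) → ∣ p ∣ ≤ m → m ≤ n → ∃ λ q → p ⊆ q × ∣ q ∣ ≡ m
⊆-extend [] z≤n z≤n = [] , id , refl
⊆-extend (inside ∷ p) (s≤s p≤m) (s≤s m≤n) =
  map (inside ∷_) (map s⊆s (cong ℕ.suc)) (⊆-extend p p≤m m≤n)
⊆-extend {ℕ.suc n} (outside ∷ p) p≤m m≤1+n with m≤n⇒m<n∨m≡n m≤1+n
... | inj₁ (s≤s m≤n) = map (outside ∷_) (map s⊆s id) (⊆-extend p p≤m m≤n)
... | inj₂ refl      = ⊤ , ⊆⊤ , ∣⊤∣≡n (ℕ.suc n)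

∈-tabulate⁺ : ∀ {n} (f : Fin n → Side) {i} → f i ≡ inside → i ∈ tabulate f
∈-tabulate⁺ f {i} fi≡inside = lookup⇒[]= i (tabulate f) (trans (lookup∘tabulate f i) fi≡inside)

∈-tabulate⁻ : ∀ {n} (f : Fin n → Side) {i} → i ∈ tabulate f → f i ≡ inside
∈-tabulate⁻ f {i} i∈ = trans (sym (lookup∘tabulate f i)) ([]=⇒lookup i∈)

-- The alphabet Z_q is split as Fin (v + k): the small letters a ↑ˡ k and the large letters v ↑ʳ c.
module Letters (v k : ℕ) where

  isSmall : Fin (v + k) → Side
  isSmall ℓ = [ const inside , const outside ]′ (splitAt v ℓ)

  -- Junk value a₀ on large letters; only its value on small letters is ever used.
  smallPart : Fin v → Fin (v + k) → Fin v
  smallPart a₀ ℓ = [ id , const a₀ ]′ (splitAt v ℓ)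

  isSmall-↑ʳ : ∀ c → isSmall (v ↑ʳ c) ≡ outside
  isSmall-↑ʳ c rewrite splitAt-↑ʳ v k c = refl

  ↑ˡ-avoids : ∀ a₀ (a : Fin v) (ℓ : Fin (v + k)) →
              (isSmall ℓ ≡ inside → a ≢ smallPart a₀ ℓ) → a ↑ˡ k ≢ ℓ
  ↑ˡ-avoids a₀ a _ avoids refl rewrite splitAt-↑ˡ v a k = avoids refl refl

  smallPositions : ∀ {n} → Word n (v + k) → Subset n
  smallPositions y = tabulate (isSmall ∘ y)

  largeLettersOccur⇒∣smallPositions∣≤ : ∀ t (y : Word (k + t) (v + k)) →
    (∀ c → ∃ λ i → y i ≡ v ↑ʳ c) → ∣ smallPositions y ∣ ≤ t
  largeLettersOccur⇒∣smallPositions∣≤ t y occurs =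
    +-cancelˡ-≤ k _ _ (m≤o∸n⇒m+n≤o k (∣p∣≤n (smallPositions y)) k≤∣∁small∣)
    where
    position : Fin k → Fin (k + t)
    position = proj₁ ∘ occurs

    position-injective : Injective _≡_ _≡_ position
    position-injective {a} {b} e =
      ↑ʳ-injective v a b (trans (sym (proj₂ (occurs a))) (trans (cong y e) (proj₂ (occurs b))))

    position∈∁small : ∀ c → position c ∈ ∁ (smallPositions y)
    position∈∁small c = x∉p⇒x∈∁p λ c∈small →
      outside≢inside (trans (sym (isSmall-↑ʳ c))
        (trans (cong isSmall (sym (proj₂ (occurs c)))) (∈-tabulate⁻ (isSmall ∘ y) c∈small)))
      where
      outside≢inside : outside ≢ inside
      outside≢inside ()

    k≤∣∁small∣ : k ≤ (k + t) ∸ ∣ smallPositions y ∣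
    k≤∣∁small∣ rewrite sym (∣∁p∣≡n∸∣p∣ (smallPositions y)) =
      injective⇒≤∣p∣ _ position position-injective position∈∁small

  constantWords : ∀ {n} → List (Word n (v + k))
  constantWords = tabulateList (λ c _ → v ↑ʳ c)

  arrayRows : ∀ {N n} → Array N n v → List (Word n (v + k))
  arrayRows M = tabulateList (λ r i → M r i ↑ˡ k)

  skirtingSet : ∀ {N n} → Array N n v → List (Word n (v + k))
  skirtingSet M = constantWords ++ arrayRows M

  length-skirtingSet : ∀ {N n} (M : Array N n v) → length (skirtingSet M) ≡ k + N
  length-skirtingSet M = trans (length-++ constantWords)
    (cong₂ _+_ (length-tabulate (λ c _ → v ↑ʳ c)) (length-tabulate (λ r i → M r i ↑ˡ k)))

  row-skirts : ∀ {n} (a₀ : Fin v) (y : Word n (v + k)) (T : Subset n) (x : Fin n → Fin v) →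
    smallPositions y ⊆ T → (∀ i → i ∈ T → x i ≢ smallPart a₀ (y i)) → Skirts (λ i → x i ↑ˡ k) y
  row-skirts a₀ y T x small⊆T x-avoids i =
    ↑ˡ-avoids a₀ (x i) (y i) (λ small → x-avoids i (small⊆T (∈-tabulate⁺ (isSmall ∘ y) small)))

  skirtingSet-isSkirtingSet : ∀ {N t} (M : Array N (k + t) v) → Fin v →
    IsSkirtingArray N t (k + t) v M → IsSkirtingSet (k + t) (v + k) (skirtingSet M)
  skirtingSet-isSkirtingSet {t = t} M a₀ isSA y with all? (λ c → any? (λ i → y i ≟ v ↑ʳ c))
  ... | no someMissing =
    let c , c∉y = ¬∀⟶∃¬ k _ (λ c → any? (λ i → y i ≟ v ↑ʳ c)) someMissing
    in ++⁺ˡ (tabulate⁺ c (λ i e → c∉y (i , sym e)))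
  ... | yes allOccur
    with T , small⊆T , ∣T∣≡t ← ⊆-extend (smallPositions y)
           (largeLettersOccur⇒∣smallPositions∣≤ t y allOccur) (m≤n+m t k)
    with r , r-avoids ← isSA T ∣T∣≡t (smallPart a₀ ∘ y)
    = ++⁺ʳ constantWords (tabulate⁺ r (row-skirts a₀ y T (M r) small⊆T r-avoids))

skirtingArray⇒fLe : ∀ {n q N} t k v → n ≡ k + t → q ≡ v + k → Fin v →
                    HasSA N t n v → fLe n q (k + N)
skirtingArray⇒fLe t k v refl refl a₀ (M , isSA) =
  skirtingSet M , skirtingSet-isSkirtingSet M a₀ isSA , ≤-reflexive (length-skirtingSet M)
  where open Letters v k

proposition4p2 : (n q v : ℕ) → 1 ≤ n → 2 ≤ q → 1 ≤ v → v < q → 1 ≤ (n + v) ∸ q →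
    (N : ℕ) → HasSA N ((n + v) ∸ q) n v → fLe n q ((q ∸ v) + N)
proposition4p2 n q v _ _ 1≤v v<q 1≤t N =
  skirtingArray⇒fLe t (q ∸ v) v n≡k+t (sym (m+[n∸m]≡n v≤q)) (fromℕ< 1≤v)
  where
  t : ℕ
  t = (n + v) ∸ q

  v≤q : v ≤ q
  v≤q = <⇒≤ v<q

  q≤n+v : q ≤ n + v
  q≤n+v = <⇒≤ (m∸n≢0⇒n<m (>⇒≢ 1≤t))

  n≡k+t : n ≡ (q ∸ v) + t
  n≡k+t = sym (+-cancelʳ-≡ v _ _ (begin
    (q ∸ v) + t + v     ≡⟨ +-assoc (q ∸ v) t v ⟩
    (q ∸ v) + (t + v)   ≡⟨ cong ((q ∸ v) +_) (+-comm t v) ⟩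
    (q ∸ v) + (v + t)   ≡⟨ +-assoc (q ∸ v) v t ⟨
    (q ∸ v) + v + t     ≡⟨ cong (_+ t) (m∸n+n≡m v≤q) ⟩
    q + t               ≡⟨ m+[n∸m]≡n q≤n+v ⟩
    n + v               ∎))
    where open ≡-Reasoning
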